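{- Let $(G,k)$ be a YES-instance of \textsc{Interval Completion} to which the Module Reduction Rule is not applicable. Let $r$ be a positive integer and $A\subseteq V(G)$. Then the number of connected components $C$ of $G\setminus A$ for which there exists $v_C\in C$ with $|A\setminus N_G(v_C)|\le r$ is at most $12kr+4k+18r+4$.
   Context: $(G,k)$ is a YES-instance of \textsc{Interval Completion} if one can add at most $k$ edges to $G$ to obtain an interval graph (intersection graph of closed intervals on a line). A set $M\subseteq V(G)$ is a module if every vertex outside $M$ is adjacent to all or to none of $M$. The Module Reduction Rule is applicable to $(G,k)$ if there exist $X\subseteq V(G)$ and $2k+3$ connected components $M_1,\dots,M_{2k+3}$ of $G\setminus X$ that are modules in $G$ with $N_G(M_i)=N_G(M_1)$ for all $i$. -}

module Defs where

open import Data.Nat using (ℕ; zero; suc; _+_; _*_; _≤_; _<_; _<?_)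
open import Data.Fin using (Fin; toℕ)
import Data.Fin as F
open import Data.Bool using (Bool; true; false; if_then_else_; _∧_; not)
open import Data.Product using (Σ; ∃; _×_; _,_)
open import Relation.Binary.PropositionalEquality using (_≡_; _≢_)
open import Relation.Nullary using (¬_)
open import Relation.Nullary.Decidable using (⌊_⌋)
open import Function.Bundles using (_⇔_)
open import Data.Sum using (_⊎_)
open import Data.Empty using (⊥)

record Graph (n : ℕ) : Set where
  field
    adj    : Fin n → Fin n → Bool
    adj-sym    : ∀ u v → adj u v ≡ adj v u
    adj-irrefl : ∀ v → adj v v ≡ false
open Graph public

VSet : ℕ → Set
VSet n = Fin n → Bool

_∈ᵥ_ : ∀ {n} → Fin n → VSet n → Set
v ∈ᵥ S = S v ≡ true

_∉ᵥ_ : ∀ {n} → Fin n → VSet n → Set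
v ∉ᵥ S = S v ≡ false

count : ∀ {n} → VSet n → ℕ
count {zero}  S = 0
count {suc n} S = (if S F.zero then 1 else 0) + count (λ i → S (F.suc i))

_⊆ᴳ_ : ∀ {n} → Graph n → Graph n → Set
G ⊆ᴳ H = ∀ u v → adj G u v ≡ true → adj H u v ≡ true

sumFin : ∀ {m} → (Fin m → ℕ) → ℕ
sumFin {zero}  f = 0
sumFin {suc m} f = f F.zero + sumFin (λ i → f (F.suc i))

addedEdges : ∀ {n} → Graph n → Graph n → ℕ
addedEdges G H = sumFin (λ u → count (λ v →
  ⌊ toℕ u <? toℕ v ⌋ ∧ adj H u v ∧ not (adj G u v)))

-- Interval graph: intersection graph of closed intervals [lo v, hi v] on a line.
-- (Endpoints in ℕ; for finitely many intervals this is w.l.o.g..)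
IsInterval : ∀ {n} → Graph n → Set
IsInterval {n} G =
  Σ (Fin n → ℕ) λ lo → Σ (Fin n → ℕ) λ hi →
    (∀ v → lo v ≤ hi v) ×
    (∀ u v → u ≢ v → (adj G u v ≡ true ⇔ (lo u ≤ hi v × lo v ≤ hi u)))

IntervalCompletionYes : ∀ {n} → Graph n → ℕ → Set
IntervalCompletionYes G k =
  ∃ λ H → G ⊆ᴳ H × IsInterval H × addedEdges G H ≤ k

IsModule : ∀ {n} → Graph n → VSet n → Set
IsModule G M = ∀ w → w ∉ᵥ M →
  (∀ u → u ∈ᵥ M → adj G w u ≡ true) ⊎ (∀ u → u ∈ᵥ M → adj G w u ≡ false)

InNbhd : ∀ {n} → Graph n → VSet n → Fin n → Set
InNbhd G M w = w ∉ᵥ M × ∃ λ u → u ∈ᵥ M × adj G u w ≡ true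

data PathIn {n} (G : Graph n) (S : VSet n) : Fin n → Fin n → Set where
  here : ∀ {v} → v ∈ᵥ S → PathIn G S v v
  step : ∀ {u w v} → u ∈ᵥ S → adj G u w ≡ true → PathIn G S w v → PathIn G S u v

IsComponentMinus : ∀ {n} → Graph n → VSet n → VSet n → Set
IsComponentMinus G X C =
  (∀ v → v ∈ᵥ C → v ∉ᵥ X) ×
  (∃ λ v → v ∈ᵥ C) ×
  (∀ u v → u ∈ᵥ C → v ∈ᵥ C → PathIn G C u v) ×
  (∀ u w → u ∈ᵥ C → w ∉ᵥ X → adj G u w ≡ true → w ∈ᵥ C)

Disjoint : ∀ {n} → VSet n → VSet n → Set
Disjoint S T = ∀ v → v ∈ᵥ S → v ∈ᵥ T → ⊥

ModuleRuleApplicable : ∀ {n} → Graph n → ℕ → Set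
ModuleRuleApplicable {n} G k =
  Σ (VSet n) λ X → Σ (Fin (3 + 2 * k) → VSet n) λ M →
    (∀ i → IsComponentMinus G X (M i)) ×
    (∀ i j → i ≢ j → Disjoint (M i) (M j)) ×
    (∀ i → IsModule G (M i)) ×
    (∀ i w → InNbhd G (M i) w ⇔ InNbhd G (M F.zero) w)

nonNbrsIn : ∀ {n} → Graph n → VSet n → Fin n → ℕ
nonNbrsIn G A v = count (λ u → A u ∧ not (adj G v u))

{-# OPTIONS --safe #-}

-- Fix an interval model of a completion H of G with at most k new edges. At most 2k of
-- the components contain an end of a new edge; the others are clean: their H-edges are
-- G-edges. Then every point of the interval of a vertex outside C ∪ A is free for a clean
-- component C (covered by no interval of C), and C, being connected, lies strictly between
-- any two free points around it. Hence the left ends p_C of the chosen vertices v_C are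
-- distinct, and v_D ends before p_C whenever p_D < p_C.
-- Let f and g be the clean components with least and greatest p, and B the at most 2r
-- vertices of A missing v_f or v_g. The signature of C is the sum over b ∈ B of the side
-- (0, 1 or 2) of p_C relative to the interval of b. It is at most 4r, and since every
-- summand is monotone in p_C, two components of equal signature see each b ∈ B on the same
-- side. Let s and t be the first and last members of a class of equal signature. A vertex
-- of A touching an inner member either lies outside B, and then its interval covers
-- [hi v_f, p_g], or lies in B, and then it covers [p_s, p_t]; either way it is complete to
-- every inner member. So the inner members are modules with a common neighbourhood, and a
-- class has at most 2k + 4 members, as otherwise the Module Reduction Rule applies. This
-- leaves at most 2k + (4r + 1)(2k + 4) components.

module Submission where

open import Defs
open import Data.Nat using (ℕ; zero; suc; _+_; _*_; _≤_; _<_; z≤n; s≤s; s≤s⁻¹; _≤?_; _<?_)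
open import Data.Nat.Properties
open import Data.Nat.Tactic.RingSolver using (solve-∀)
open import Data.Fin using (Fin; toℕ)
import Data.Fin as F
import Data.Fin.Properties as Finₚ
open Finₚ using (any?) renaming (_≟_ to _≟ᶠ_)
open import Data.Bool using (Bool; true; false; _∧_; _∨_; not; if_then_else_)
open import Data.Bool.Properties
  using (∧-conicalˡ; ∧-conicalʳ; ∧-zeroʳ; ∧-identityʳ; not-¬; ¬-not) renaming (_≟_ to _≟ᵇ_)
open import Data.Product using (Σ; ∃; _×_; _,_; proj₁; proj₂)
open import Data.Sum using (_⊎_; inj₁; inj₂)
open import Data.Empty using (⊥; ⊥-elim)
open import Data.Vec.Functional using (_∷_)
open import Function using (_∘_; flip)
open import Function.Bundles using (_⇔_; mk⇔; Equivalence)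
open import Function.Definitions using (Injective)
open import Relation.Binary.Core using (Rel)
open import Relation.Binary.Definitions using (Total; Transitive)
open import Relation.Binary.PropositionalEquality
open import Relation.Nullary using (¬_; Dec; yes; no; does)
open import Relation.Nullary.Decidable using (⌊_⌋; dec-true; decidable-stable)
open import Algebra.Properties.CommutativeSemigroup +-commutativeSemigroup using (interchange)

bit : Bool → ℕ
bit b = if b then 1 else 0

from-does : ∀ {ℓ} {P : Set ℓ} (P? : Dec P) → does P? ≡ true → P
from-does (yes p) _ = p

from-not-does : ∀ {ℓ} {P : Set ℓ} (P? : Dec P) → not (does P?) ≡ true → ¬ P
from-not-does (no ¬p) _ = ¬p

not≡true⇒≡false : ∀ {x} → not x ≡ true → x ≡ false
not≡true⇒≡false {false} _ = refl

not∨not≡false⇒both : ∀ {x y} → not x ∨ not y ≡ false → x ≡ true × y ≡ true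
not∨not≡false⇒both {true} {true} _ = refl , refl
not∨not≡false⇒both {true} {false} ()
not∨not≡false⇒both {false} ()

anyᵇ : ∀ {n} → (Fin n → Bool) → Bool
anyᵇ f = does (any? λ i → f i ≟ᵇ true)

anyᵇ-intro : ∀ {n} (f : Fin n → Bool) {i} → f i ≡ true → anyᵇ f ≡ true
anyᵇ-intro f {i} fi = dec-true (any? _) (i , fi)

anyᵇ-witness : ∀ {n} (f : Fin n → Bool) → anyᵇ f ≡ true → ∃ λ i → f i ≡ true
anyᵇ-witness f = from-does (any? _)

bit-pos : ∀ {b} → b ≡ true → 1 ≤ bit b
bit-pos refl = s≤s z≤n

bit-≤1 : ∀ b → bit b ≤ 1
bit-≤1 true = ≤-refl
bit-≤1 false = z≤n

bit-does-mono : ∀ {ℓ ℓ′} {P : Set ℓ} {Q : Set ℓ′} (P? : Dec P) (Q? : Dec Q) →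
  (P → Q) → bit (does P?) ≤ bit (does Q?)
bit-does-mono (no _) _ _ = z≤n
bit-does-mono (yes _) (yes _) _ = ≤-refl
bit-does-mono (yes p) (no ¬q) p⇒q = ⊥-elim (¬q (p⇒q p))

sumFin-cong : ∀ {m} {f g : Fin m → ℕ} → (∀ i → f i ≡ g i) → sumFin f ≡ sumFin g
sumFin-cong {zero} _ = refl
sumFin-cong {suc m} f≗g = cong₂ _+_ (f≗g F.zero) (sumFin-cong (f≗g ∘ F.suc))

sumFin-mono : ∀ {m} {f g : Fin m → ℕ} → (∀ i → f i ≤ g i) → sumFin f ≤ sumFin g
sumFin-mono {zero} _ = z≤n
sumFin-mono {suc m} f≤g = +-mono-≤ (f≤g F.zero) (sumFin-mono (f≤g ∘ F.suc))

sumFin-+ : ∀ {m} (f g : Fin m → ℕ) → sumFin (λ i → f i + g i) ≡ sumFin f + sumFin g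
sumFin-+ {zero} _ _ = refl
sumFin-+ {suc m} f g =
  trans (cong (f F.zero + g F.zero +_) (sumFin-+ (f ∘ F.suc) (g ∘ F.suc)))
        (interchange (f F.zero) (g F.zero) (sumFin (f ∘ F.suc)) (sumFin (g ∘ F.suc)))

sumFin-zero : ∀ {m} → sumFin {m} (λ _ → 0) ≡ 0
sumFin-zero {zero} = refl
sumFin-zero {suc m} = sumFin-zero {m}

sumFin-swap : ∀ {m l} (f : Fin m → Fin l → ℕ) →
  sumFin (λ i → sumFin (f i)) ≡ sumFin (λ j → sumFin (λ i → f i j))
sumFin-swap {zero} {l} _ = sym (sumFin-zero {l})
sumFin-swap {suc m} f =
  trans (cong (sumFin (f F.zero) +_) (sumFin-swap (f ∘ F.suc)))
        (sym (sumFin-+ (f F.zero) (λ j → sumFin (λ i → f (F.suc i) j))))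

+-mono-≤-tight : ∀ {a b c d} → a ≤ c → b ≤ d → a + b ≡ c + d → a ≡ c × b ≡ d
+-mono-≤-tight {a} {b} {c} {d} a≤c b≤d eq =
  a≡c , +-cancelˡ-≡ c b d (subst (λ x → x + b ≡ c + d) a≡c eq)
  where
  a≡c : a ≡ c
  a≡c = ≤-antisym a≤c (+-cancelʳ-≤ d c a (≤-trans (≤-reflexive (sym eq)) (+-monoʳ-≤ a b≤d)))

sumFin-mono-tight : ∀ {m} {f g : Fin m → ℕ} → (∀ i → f i ≤ g i) → sumFin f ≡ sumFin g →
  ∀ i → f i ≡ g i
sumFin-mono-tight f≤g eq F.zero = proj₁ (+-mono-≤-tight (f≤g F.zero) (sumFin-mono (f≤g ∘ F.suc)) eq)
sumFin-mono-tight f≤g eq (F.suc i) = sumFin-mono-tight (f≤g ∘ F.suc)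
  (proj₂ (+-mono-≤-tight (f≤g F.zero) (sumFin-mono (f≤g ∘ F.suc)) eq)) i

count≡sumFin : ∀ {n} (S : VSet n) → count S ≡ sumFin (bit ∘ S)
count≡sumFin {zero} _ = refl
count≡sumFin {suc n} S = cong (bit (S F.zero) +_) (count≡sumFin (S ∘ F.suc))

count-none : ∀ {n} {S : VSet n} → (∀ i → S i ≡ false) → count S ≡ 0
count-none {zero} _ = refl
count-none {suc n} {S} none rewrite none F.zero = count-none (none ∘ F.suc)

count-≤-sumFin : ∀ {n} {S : VSet n} {f : Fin n → ℕ} → (∀ i → S i ≡ true → 1 ≤ f i) →
  count S ≤ sumFin f
count-≤-sumFin {zero} _ = z≤n
count-≤-sumFin {suc n} {S} {f} hit with S F.zero in S0
... | true = +-mono-≤ (hit F.zero S0) (count-≤-sumFin (hit ∘ F.suc))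
... | false = ≤-trans (count-≤-sumFin (hit ∘ F.suc)) (m≤n+m _ (f F.zero))

count-pos : ∀ {n} {S : VSet n} {i} → S i ≡ true → 1 ≤ count S
count-pos {i = F.zero} Si rewrite Si = s≤s z≤n
count-pos {S = S} {F.suc i} Si = ≤-trans (count-pos {S = S ∘ F.suc} Si) (m≤n+m _ (bit (S F.zero)))

count-witness : ∀ {n} {S : VSet n} → 1 ≤ count S → ∃ λ i → S i ≡ true
count-witness {suc n} {S} 1≤count with S F.zero in S0
... | true = F.zero , S0
... | false with count-witness {S = S ∘ F.suc} 1≤count
...   | i , Si = F.suc i , Si

count-mono : ∀ {n} {S U : VSet n} → (∀ i → S i ≡ true → U i ≡ true) → count S ≤ count U
count-mono {U = U} S⊆U =
  ≤-trans (count-≤-sumFin λ i Si → bit-pos (S⊆U i Si)) (≤-reflexive (sym (count≡sumFin U)))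

count-union : ∀ {n} {S U V : VSet n} → (∀ i → S i ≡ true → U i ≡ true ⊎ V i ≡ true) →
  count S ≤ count U + count V
count-union {S = S} {U} {V} S⊆U∪V = begin
  count S                              ≤⟨ count-≤-sumFin (λ i Si → at-least-one (S⊆U∪V i Si)) ⟩
  sumFin (λ i → bit (U i) + bit (V i)) ≡⟨ sumFin-+ (bit ∘ U) (bit ∘ V) ⟩
  sumFin (bit ∘ U) + sumFin (bit ∘ V)  ≡⟨ sym (cong₂ _+_ (count≡sumFin U) (count≡sumFin V)) ⟩
  count U + count V                    ∎
  where
  open ≤-Reasoning
  at-least-one : ∀ {u v} → u ≡ true ⊎ v ≡ true → 1 ≤ bit u + bit v
  at-least-one {v = v} (inj₁ refl) = s≤s z≤n
  at-least-one {u} (inj₂ refl) = ≤-trans (s≤s z≤n) (m≤n+m 1 (bit u))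

count-≤1 : ∀ {n} {S : VSet n} → (∀ i j → S i ≡ true → S j ≡ true → i ≡ j) → count S ≤ 1
count-≤1 {zero} _ = z≤n
count-≤1 {suc n} {S} unique with S F.zero in S0
... | true = s≤s (≤-reflexive (count-none λ i →
  ¬-not λ Si → Finₚ.0≢1+n (unique F.zero (F.suc i) S0 Si)))
... | false = count-≤1 λ i j Si Sj → Finₚ.suc-injective (unique (F.suc i) (F.suc j) Si Sj)

count-+-count-not : ∀ {n} (S : VSet n) → count S + count (not ∘ S) ≡ n
count-+-count-not {zero} _ = refl
count-+-count-not {suc n} S with S F.zero
... | true = cong suc (count-+-count-not (S ∘ F.suc))
... | false = trans (+-suc _ _) (cong suc (count-+-count-not (S ∘ F.suc)))

count-transpose : ∀ {m n} (R : Fin m → Fin n → Bool) →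
  sumFin (λ i → count (R i)) ≡ sumFin (λ j → count (λ i → R i j))
count-transpose R = begin
  sumFin (λ i → count (R i))                   ≡⟨ sumFin-cong (λ i → count≡sumFin (R i)) ⟩
  sumFin (λ i → sumFin (λ j → bit (R i j)))    ≡⟨ sumFin-swap (λ i j → bit (R i j)) ⟩
  sumFin (λ j → sumFin (λ i → bit (R i j)))    ≡⟨ sym (sumFin-cong (λ j → count≡sumFin (λ i → R i j))) ⟩
  sumFin (λ j → count (λ i → R i j))           ∎
  where open ≡-Reasoning

count-remove : ∀ {n} {S : VSet n} (a : Fin n) →
  count S ≤ 1 + count (λ j → S j ∧ not (does (a ≟ᶠ j)))
count-remove {S = S} a = ≤-trans (count-union split) (+-monoˡ-≤ _ (count-≤1 single))
  where
  split : ∀ j → S j ≡ true → does (a ≟ᶠ j) ≡ true ⊎ (S j ∧ not (does (a ≟ᶠ j))) ≡ true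
  split j Sj with a ≟ᶠ j
  ... | yes _ = inj₁ refl
  ... | no _ = inj₂ (cong₂ _∧_ Sj refl)
  single : ∀ i j → does (a ≟ᶠ i) ≡ true → does (a ≟ᶠ j) ≡ true → i ≡ j
  single i j a≡i a≡j = trans (sym (from-does (a ≟ᶠ i) a≡i)) (from-does (a ≟ᶠ j) a≡j)

count-≤-fibres : ∀ {n} {S : VSet n} (key : Fin n → ℕ) (N c : ℕ) →
  (∀ i → S i ≡ true → key i < N) →
  (∀ s → count (λ i → S i ∧ does (key i ≟ s)) ≤ c) →
  count S ≤ N * c
count-≤-fibres key zero c below _ = ≤-reflexive (count-none λ i → ¬-not λ Si → n≮0 (below i Si))
count-≤-fibres {S = S} key (suc N) c below fibre = begin
  count S                                          ≤⟨ count-union split ⟩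
  count (λ i → S i ∧ does (key i ≟ N)) + count S<N ≤⟨ +-mono-≤ (fibre N) (count-≤-fibres key N c below-N fibre-N) ⟩
  c + N * c                                        ∎
  where
  open ≤-Reasoning
  S<N : VSet _
  S<N i = S i ∧ does (key i <? N)
  split : ∀ i → S i ≡ true → (S i ∧ does (key i ≟ N)) ≡ true ⊎ S<N i ≡ true
  split i Si with key i ≟ N | key i <? N
  ... | yes i≡N | _ = inj₁ (cong₂ _∧_ Si (dec-true (key i ≟ N) i≡N))
  ... | no _ | yes i<N = inj₂ (cong₂ _∧_ Si (dec-true (key i <? N) i<N))
  ... | no i≢N | no i≮N = ⊥-elim (i≢N (≤-antisym (s≤s⁻¹ (below i Si)) (≮⇒≥ i≮N)))
  below-N : ∀ i → S<N i ≡ true → key i < N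
  below-N i e = from-does (key i <? N) (∧-conicalʳ (S i) _ e)
  fibre-N : ∀ s → count (λ i → S<N i ∧ does (key i ≟ s)) ≤ c
  fibre-N s = ≤-trans (count-mono drop-<N) (fibre s)
    where
    drop-<N : ∀ i → (S<N i ∧ does (key i ≟ s)) ≡ true → (S i ∧ does (key i ≟ s)) ≡ true
    drop-<N i e = cong₂ _∧_ (∧-conicalˡ (S i) _ (∧-conicalˡ (S<N i) _ e)) (∧-conicalʳ (S<N i) _ e)

enumerate : ∀ {n} (S : VSet n) {t} → t ≤ count S →
  Σ (Fin t → Fin n) λ e → Injective _≡_ _≡_ e × (∀ i → S (e i) ≡ true)
enumerate S {zero} _ = (λ ()) , (λ { {()} }) , (λ ())
enumerate {suc n} S {suc t} t≤ with S F.zero in S0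
... | true with enumerate (S ∘ F.suc) (s≤s⁻¹ t≤)
...   | e , e-inj , e∈S = F.zero ∷ (F.suc ∘ e) , cons-inj , λ { F.zero → S0 ; (F.suc i) → e∈S i }
  where
  cons-inj : Injective _≡_ _≡_ (F.zero ∷ (F.suc ∘ e))
  cons-inj {F.zero} {F.zero} _ = refl
  cons-inj {F.suc i} {F.suc j} eq = cong F.suc (e-inj (Finₚ.suc-injective eq))
enumerate {suc n} S {suc t} t≤ | false with enumerate (S ∘ F.suc) t≤
...   | e , e-inj , e∈S = F.suc ∘ e , e-inj ∘ Finₚ.suc-injective , e∈S

module _ {a ℓ} {A : Set a} {_≼_ : Rel A ℓ} (total : Total _≼_) (trans≼ : Transitive _≼_) where

  private
    refl≼ : ∀ {x} → x ≼ x
    refl≼ {x} with total x x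
    ... | inj₁ x≼x = x≼x
    ... | inj₂ x≼x = x≼x

  extremum : ∀ {m} (S : Fin m → Bool) (key : Fin m → A) → ∃ (λ i → S i ≡ true) →
    ∃ λ b → S b ≡ true × (∀ j → S j ≡ true → key b ≼ key j)
  extremum {suc m} S key (i , Si) with any? (λ j → S (F.suc j) ≟ᵇ true)
  ... | no none = F.zero , only-zero i Si , λ { F.zero _ → refl≼ ; (F.suc j) Sj → ⊥-elim (none (j , Sj)) }
    where
    only-zero : ∀ i → S i ≡ true → S F.zero ≡ true
    only-zero F.zero Si = Si
    only-zero (F.suc i) Si = ⊥-elim (none (i , Si))
  ... | yes some with extremum (S ∘ F.suc) (key ∘ F.suc) some | S F.zero in S0
  ...   | b , Sb , best | false =
    F.suc b , Sb , λ { F.zero S0′ → ⊥-elim (not-¬ S0′ S0) ; (F.suc j) → best j }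
  ...   | b , Sb , best | true with total (key F.zero) (key (F.suc b))
  ...     | inj₁ 0≼b = F.zero , S0 , λ { F.zero _ → refl≼ ; (F.suc j) Sj → trans≼ 0≼b (best j Sj) }
  ...     | inj₂ b≼0 = F.suc b , Sb , λ { F.zero _ → b≼0 ; (F.suc j) → best j }

count-anyᵇ-≤ : ∀ {m n} (R : Fin m → Fin n → Bool) →
  count (λ i → anyᵇ (R i)) ≤ sumFin (λ i → count (R i))
count-anyᵇ-≤ R = count-≤-sumFin λ i hit → count-pos {S = R i} (proj₂ (anyᵇ-witness (R i) hit))

count-meeting : ∀ {m n} {C : Fin m → VSet n} (T : VSet n) →
  (∀ i j → i ≢ j → Disjoint (C i) (C j)) →
  count (λ i → anyᵇ (λ u → C i u ∧ T u)) ≤ count T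
count-meeting {C = C} T disjoint = begin
  count (λ i → anyᵇ (λ u → C i u ∧ T u)) ≤⟨ count-anyᵇ-≤ (λ i u → C i u ∧ T u) ⟩
  sumFin (λ i → count (λ u → C i u ∧ T u)) ≡⟨ count-transpose (λ i u → C i u ∧ T u) ⟩
  sumFin (λ u → count (λ i → C i u ∧ T u)) ≤⟨ sumFin-mono at-most-one ⟩
  sumFin (bit ∘ T)                         ≡⟨ sym (count≡sumFin T) ⟩
  count T                                  ∎
  where
  open ≤-Reasoning
  at-most-one : ∀ u → count (λ i → C i u ∧ T u) ≤ bit (T u)
  at-most-one u with T u
  ... | false = ≤-reflexive (count-none λ i → ∧-zeroʳ (C i u))
  ... | true = count-≤1 λ i j i∋u j∋u → decidable-stable (i ≟ᶠ j) λ i≢j →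
    disjoint i j i≢j u (trans (sym (∧-identityʳ (C i u))) i∋u) (trans (sym (∧-identityʳ (C j u))) j∋u)

module _ {n} (G H : Graph n) where

  newEdge : Fin n → Fin n → Bool
  newEdge u w = adj H u w ∧ not (adj G u w)

  onNewEdge : Fin n → Bool
  onNewEdge u = anyᵇ (newEdge u)

  count-onNewEdge : count onNewEdge ≤ 2 * addedEdges G H
  count-onNewEdge = begin
    count onNewEdge                                ≤⟨ count-anyᵇ-≤ newEdge ⟩
    sumFin (λ u → count (newEdge u))               ≤⟨ sumFin-mono (λ u → count-union (oriented u)) ⟩
    sumFin (λ u → count (upward u) + count (downward u))
                                                   ≡⟨ sumFin-+ (count ∘ upward) (count ∘ downward) ⟩
    addedEdges G H + sumFin (count ∘ downward)     ≡⟨ cong (addedEdges G H +_) (count-transpose upward) ⟨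
    addedEdges G H + addedEdges G H                ≡⟨ cong (addedEdges G H +_) (+-identityʳ _) ⟨
    2 * addedEdges G H                             ∎
    where
    open ≤-Reasoning
    upward : Fin n → Fin n → Bool
    upward u w = ⌊ toℕ u <? toℕ w ⌋ ∧ newEdge u w
    downward : Fin n → Fin n → Bool
    downward u w = upward w u
    oriented : ∀ u w → newEdge u w ≡ true → upward u w ≡ true ⊎ downward u w ≡ true
    oriented u w new with toℕ u <? toℕ w | toℕ w <? toℕ u
    ... | yes _ | _ = inj₁ new
    ... | no _ | yes _ = inj₂ (trans (cong₂ (λ h g → h ∧ not g) (adj-sym H w u) (adj-sym G w u)) new)
    ... | no u≮w | no w≮u with Finₚ.toℕ-injective (≤-antisym (≮⇒≥ w≮u) (≮⇒≥ u≮w))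
    ...   | refl = ⊥-elim (not-¬ (∧-conicalˡ (adj H u u) _ new) (adj-irrefl H u))

side : ℕ → ℕ → ℕ → ℕ
side l h x = bit (does (l ≤? x)) + bit (does (h <? x))

side-mono : ∀ {l h x y} → x ≤ y → side l h x ≤ side l h y
side-mono {l} {h} {x} {y} x≤y =
  +-mono-≤ (bit-does-mono (l ≤? x) (l ≤? y) (λ l≤x → ≤-trans l≤x x≤y))
           (bit-does-mono (h <? x) (h <? y) (λ h<x → <-≤-trans h<x x≤y))

side-≤2 : ∀ l h x → side l h x ≤ 2
side-≤2 l h x = +-mono-≤ (bit-≤1 (does (l ≤? x))) (bit-≤1 (does (h <? x)))

private
  same-side-bits : ∀ {P Q R T : Set} (P? : Dec P) (Q? : Dec Q) (R? : Dec R) (T? : Dec T) →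
    ¬ Q → R →
    bit (does P?) + bit (does Q?) ≡ bit (does R?) + bit (does T?) → P × ¬ T
  same-side-bits _ (yes q) _ _ ¬q _ _ = ⊥-elim (¬q q)
  same-side-bits _ _ (no ¬r) _ _ r _ = ⊥-elim (¬r r)
  same-side-bits (yes p) (no _) (yes _) (no ¬t) _ _ _ = p , ¬t
  same-side-bits (yes _) (no _) (yes _) (yes _) _ _ ()
  same-side-bits (no _) (no _) (yes _) _ _ _ ()

same-side⇒spans : ∀ {l h x y} → l < y → x < h → side l h x ≡ side l h y → l ≤ x × y ≤ h
same-side⇒spans {l} {h} {x} {y} l<y x<h same
  with same-side-bits (l ≤? x) (h <? x) (l ≤? y) (h <? y) (<⇒≯ x<h) (<⇒≤ l<y) same
... | l≤x , h≮y = l≤x , ≮⇒≥ h≮y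

argmin : ∀ {m} (S : Fin m → Bool) (key : Fin m → ℕ) → ∃ (λ i → S i ≡ true) →
  ∃ λ b → S b ≡ true × (∀ j → S j ≡ true → key b ≤ key j)
argmin = extremum ≤-total ≤-trans

argmax : ∀ {m} (S : Fin m → Bool) (key : Fin m → ℕ) → ∃ (λ i → S i ≡ true) →
  ∃ λ b → S b ≡ true × (∀ j → S j ≡ true → key j ≤ key b)
argmax = extremum (flip ≤-total) (flip ≤-trans)

module Component {n} {G : Graph n} {A C : VSet n} (isComponent : IsComponentMinus G A C) where

  avoids : ∀ {v} → v ∈ᵥ C → v ∉ᵥ A
  avoids = proj₁ isComponent _

  walk : ∀ {u v} → u ∈ᵥ C → v ∈ᵥ C → PathIn G C u v
  walk = proj₁ (proj₂ (proj₂ isComponent)) _ _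

  closed : ∀ {u w} → u ∈ᵥ C → w ∉ᵥ A → adj G u w ≡ true → w ∈ᵥ C
  closed = proj₂ (proj₂ (proj₂ isComponent)) _ _

module IntervalModel {n} (G H : Graph n) (G⊆H : G ⊆ᴳ H) (lo hi : Fin n → ℕ)
  (lo≤hi : ∀ v → lo v ≤ hi v)
  (model : ∀ u v → u ≢ v → (adj H u v ≡ true ⇔ (lo u ≤ hi v × lo v ≤ hi u))) where

  Covers : Fin n → ℕ → Set
  Covers v x = lo v ≤ x × x ≤ hi v

  covers-lo : ∀ v → Covers v (lo v)
  covers-lo v = ≤-refl , lo≤hi v

  covers-hi : ∀ v → Covers v (hi v)
  covers-hi v = lo≤hi v , ≤-refl

  adj⇒overlap : ∀ {u v} → adj G u v ≡ true → lo u ≤ hi v × lo v ≤ hi u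
  adj⇒overlap {u} {v} uv = Equivalence.to (model u v u≢v) (G⊆H u v uv)
    where
    u≢v : u ≢ v
    u≢v refl = not-¬ (G⊆H u u uv) (adj-irrefl H u)

  overlap⇒adjᴴ : ∀ {u v} → u ≢ v → lo u ≤ hi v → lo v ≤ hi u → adj H u v ≡ true
  overlap⇒adjᴴ {u} {v} u≢v lu≤hv lv≤hu = Equivalence.from (model u v u≢v) (lu≤hv , lv≤hu)

  walk-covers : ∀ {S u v x} → PathIn G S u v → lo u ≤ x → x ≤ hi v → ∃ λ w → w ∈ᵥ S × Covers w x
  walk-covers (here v∈S) lv≤x x≤hv = _ , v∈S , lv≤x , x≤hv
  walk-covers {x = x} (step {u} u∈S uw rest) lu≤x x≤hv with x ≤? hi u
  ... | yes x≤hu = u , u∈S , lu≤x , x≤hu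
  ... | no x≰hu = walk-covers rest (≤-trans (proj₂ (adj⇒overlap uw)) (<⇒≤ (≰⇒> x≰hu))) x≤hv

  Clean : VSet n → Set
  Clean S = ∀ u w → u ∈ᵥ S → adj H u w ≡ true → adj G u w ≡ true

  Free : VSet n → ℕ → Set
  Free S x = ∀ w → w ∈ᵥ S → ¬ Covers w x

  module _ {A S : VSet n} (isComponent : IsComponentMinus G A S) where
    open Component isComponent

    outside-free : Clean S → ∀ {z x} → z ∉ᵥ S → z ∉ᵥ A → Covers z x → Free S x
    outside-free clean {z} z∉S z∉A (lz≤x , x≤hz) w w∈S (lw≤x , x≤hw) =
      not-¬ (closed w∈S z∉A (clean w z w∈S (overlap⇒adjᴴ w≢z (≤-trans lw≤x x≤hz) (≤-trans lz≤x x≤hw))))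
            z∉S
      where
      w≢z : w ≢ z
      w≢z refl = not-¬ w∈S z∉S

    free-uncrossed : ∀ {x u v} → Free S x → u ∈ᵥ S → v ∈ᵥ S → lo u ≤ x → x ≤ hi v → ⊥
    free-uncrossed free u∈S v∈S lu≤x x≤hv with walk-covers (walk u∈S v∈S) lu≤x x≤hv
    ... | w , w∈S , covers = free w w∈S covers

    between-free : ∀ {x y v} → Free S x → Free S y → v ∈ᵥ S → x < lo v → lo v < y →
      ∀ {u} → u ∈ᵥ S → x < lo u × hi u < y
    between-free free-x free-y v∈S x<lv lv<y u∈S =
      ≰⇒> (λ lu≤x → free-uncrossed free-x u∈S v∈S lu≤x (≤-trans (<⇒≤ x<lv) (lo≤hi _))) ,
      ≰⇒> (λ y≤hu → free-uncrossed free-y v∈S u∈S (<⇒≤ lv<y) y≤hu)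

    spanning⇒complete : Clean S → ∀ {x y v b} → Free S x → Free S y → v ∈ᵥ S → x < lo v → lo v < y →
      b ∈ᵥ A → lo b ≤ x → y ≤ hi b → ∀ {u} → u ∈ᵥ S → adj G u b ≡ true
    spanning⇒complete clean free-x free-y v∈S x<lv lv<y b∈A lb≤x y≤hb {u} u∈S =
      clean u _ u∈S (overlap⇒adjᴴ u≢b (≤-trans (lo≤hi u) (≤-trans (<⇒≤ hu<y) y≤hb))
                                      (≤-trans lb≤x (≤-trans (<⇒≤ x<lu) (lo≤hi u))))
      where
      x<lu = proj₁ (between-free free-x free-y v∈S x<lv lv<y u∈S)
      hu<y = proj₂ (between-free free-x free-y v∈S x<lv lv<y u∈S)
      u≢b : u ≢ _
      u≢b refl = not-¬ b∈A (avoids u∈S)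

  module Family {A : VSet n} {m} (C : Fin m → VSet n)
    (isComponent : ∀ i → IsComponentMinus G A (C i))
    (disjoint : ∀ i j → i ≢ j → Disjoint (C i) (C j))
    (rep : Fin m → Fin n) (rep∈C : ∀ i → rep i ∈ᵥ C i) where

    pos : Fin m → ℕ
    pos i = lo (rep i)

    dirty : Fin m → Bool
    dirty i = anyᵇ (λ u → C i u ∧ onNewEdge G H u)

    count-dirty : count dirty ≤ 2 * addedEdges G H
    count-dirty = ≤-trans (count-meeting (onNewEdge G H) disjoint) (count-onNewEdge G H)

    not-dirty⇒Clean : ∀ {j} → not (dirty j) ≡ true → Clean (C j)
    not-dirty⇒Clean {j} not-dirty u w u∈C uw with adj G u w in old
    ... | true = refl
    ... | false = ⊥-elim (not-¬ j-dirty (not≡true⇒≡false not-dirty))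
      where
      j-dirty : dirty j ≡ true
      j-dirty = anyᵇ-intro (λ u → C j u ∧ onNewEdge G H u)
                  (cong₂ _∧_ u∈C (anyᵇ-intro (newEdge G H u) (cong₂ _∧_ uw (cong not old))))

    rep-free : ∀ {i j x} → Clean (C j) → i ≢ j → Covers (rep i) x → Free (C j) x
    rep-free {i} {j} clean i≢j =
      outside-free (isComponent j) clean (¬-not λ i∈Cj → disjoint i j i≢j (rep i) (rep∈C i) i∈Cj)
                   (Component.avoids (isComponent i) (rep∈C i))

    pos-injective : ∀ {i j} → Clean (C j) → i ≢ j → pos i ≢ pos j
    pos-injective {i} {j} clean i≢j pos-i≡pos-j =
      rep-free clean i≢j (subst (Covers (rep i)) pos-i≡pos-j (covers-lo (rep i)))
               (rep j) (rep∈C j) (covers-lo (rep j))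

    ends-before : ∀ {i j} → Clean (C j) → i ≢ j → pos i < pos j → hi (rep i) < pos j
    ends-before {i} {j} clean i≢j pos-i<pos-j = ≰⇒> λ pos-j≤hi →
      rep-free clean i≢j (<⇒≤ pos-i<pos-j , pos-j≤hi) (rep j) (rep∈C j) (covers-lo (rep j))

    module CleanComponents (r : ℕ) (few : ∀ i → nonNbrsIn G A (rep i) ≤ r)
      (clean : Fin m → Bool) (clean⇒Clean : ∀ {j} → clean j ≡ true → Clean (C j)) where

      module Signature (f g : Fin m)
        (f-min : ∀ j → clean j ≡ true → pos f ≤ pos j)
        (g-max : ∀ j → clean j ≡ true → pos j ≤ pos g) where

        Missed : VSet n
        Missed b = A b ∧ (not (adj G (rep f) b) ∨ not (adj G (rep g) b))

        count-Missed : count Missed ≤ r + r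
        count-Missed = ≤-trans (count-union split) (+-mono-≤ (few f) (few g))
          where
          split : ∀ b → Missed b ≡ true →
            (A b ∧ not (adj G (rep f) b)) ≡ true ⊎ (A b ∧ not (adj G (rep g) b)) ≡ true
          split b missed with A b | adj G (rep f) b
          ... | true | false = inj₁ refl
          ... | true | true = inj₂ missed

        weight : ℕ → Fin n → ℕ
        weight x b = if Missed b then side (lo b) (hi b) x else 0

        weight-mono : ∀ {x y} → x ≤ y → ∀ b → weight x b ≤ weight y b
        weight-mono x≤y b with Missed b
        ... | true = side-mono {lo b} {hi b} x≤y
        ... | false = z≤n

        signature : Fin m → ℕ
        signature j = sumFin (weight (pos j))

        signature-< : ∀ j → signature j < suc ((r + r) + (r + r))
        signature-< j = s≤s (begin
          signature j                                    ≤⟨ sumFin-mono weight-≤ ⟩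
          sumFin (λ b → bit (Missed b) + bit (Missed b)) ≡⟨ sumFin-+ (bit ∘ Missed) (bit ∘ Missed) ⟩
          sumFin (bit ∘ Missed) + sumFin (bit ∘ Missed)  ≡⟨ cong₂ _+_ (count≡sumFin Missed) (count≡sumFin Missed) ⟨
          count Missed + count Missed                    ≤⟨ +-mono-≤ count-Missed count-Missed ⟩
          (r + r) + (r + r)                              ∎)
          where
          open ≤-Reasoning
          weight-≤ : ∀ b → weight (pos j) b ≤ bit (Missed b) + bit (Missed b)
          weight-≤ b with Missed b
          ... | true = side-≤2 (lo b) (hi b) (pos j)
          ... | false = z≤n

        same-signature⇒same-side : ∀ {a c} → pos a ≤ pos c → signature a ≡ signature c →
          ∀ {b} → Missed b ≡ true → side (lo b) (hi b) (pos a) ≡ side (lo b) (hi b) (pos c)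
        same-signature⇒same-side {a} {c} pos-a≤pos-c same {b} missed =
          subst (λ t → (if t then side (lo b) (hi b) (pos a) else 0) ≡
                       (if t then side (lo b) (hi b) (pos c) else 0))
                missed (sumFin-mono-tight (weight-mono pos-a≤pos-c) same b)

        adjacent-unless-Missed : ∀ {b} → b ∈ᵥ A → Missed b ≡ false →
          adj G (rep f) b ≡ true × adj G (rep g) b ≡ true
        adjacent-unless-Missed {b} b∈A not-missed = not∨not≡false⇒both
          (subst (λ a → (a ∧ (not (adj G (rep f) b) ∨ not (adj G (rep g) b))) ≡ false) b∈A not-missed)

        group : ℕ → Fin m → Bool
        group s j = clean j ∧ does (signature j ≟ s)

        group⇒clean : ∀ {s j} → group s j ≡ true → clean j ≡ true
        group⇒clean {s} {j} = ∧-conicalˡ (clean j) (does (signature j ≟ s))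

        group⇒signature : ∀ {s j} → group s j ≡ true → signature j ≡ s
        group⇒signature {s} {j} e = from-does (signature j ≟ s) (∧-conicalʳ (clean j) _ e)

        module LargeGroup (k s : ℕ) (large : 5 + 2 * k ≤ count (group s)) where

          member : ∃ λ j → group s j ≡ true
          member = count-witness {S = group s} (≤-trans (s≤s z≤n) large)

          first-spec : ∃ λ b → group s b ≡ true × (∀ j → group s j ≡ true → pos b ≤ pos j)
          first-spec = argmin (group s) pos member

          last-spec : ∃ λ b → group s b ≡ true × (∀ j → group s j ≡ true → pos j ≤ pos b)
          last-spec = argmax (group s) pos member

          first last : Fin m
          first = proj₁ first-spec
          last = proj₁ last-spec

          first∈group : group s first ≡ true
          first∈group = proj₁ (proj₂ first-spec)

          last∈group : group s last ≡ true
          last∈group = proj₁ (proj₂ last-spec)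

          first-min : ∀ j → group s j ≡ true → pos first ≤ pos j
          first-min = proj₂ (proj₂ first-spec)

          last-max : ∀ j → group s j ≡ true → pos j ≤ pos last
          last-max = proj₂ (proj₂ last-spec)

          interior : Fin m → Bool
          interior j = (group s j ∧ not (does (first ≟ᶠ j))) ∧ not (does (last ≟ᶠ j))

          count-interior : 3 + 2 * k ≤ count interior
          count-interior = s≤s⁻¹ (s≤s⁻¹ (≤-trans large (≤-trans (count-remove {S = group s} first)
                                                         (s≤s (count-remove last)))))

          record Interior (j : Fin m) : Set where
            field
              in-group : group s j ≡ true
              first≢j : first ≢ j
              last≢j : last ≢ j

            j-Clean : Clean (C j)
            j-Clean = clean⇒Clean (group⇒clean in-group)

            first-free : Free (C j) (pos first)
            first-free = rep-free j-Clean first≢j (covers-lo (rep first))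

            last-free : Free (C j) (pos last)
            last-free = rep-free j-Clean last≢j (covers-lo (rep last))

            first<j : pos first < pos j
            first<j = ≤∧≢⇒< (first-min j in-group) (pos-injective j-Clean first≢j)

            j<last : pos j < pos last
            j<last = ≤∧≢⇒< (last-max j in-group) (pos-injective j-Clean last≢j ∘ sym)

            f<j : pos f < pos j
            f<j = ≤-<-trans (f-min first (group⇒clean first∈group)) first<j

            j<g : pos j < pos g
            j<g = <-≤-trans j<last (g-max last (group⇒clean last∈group))

            f≢j : f ≢ j
            f≢j refl = <-irrefl refl f<j

            g≢j : g ≢ j
            g≢j refl = <-irrefl refl j<g

          interior⇒Interior : ∀ {j} → interior j ≡ true → Interior j
          interior⇒Interior {j} int = record
            { in-group = ∧-conicalˡ (group s j) _ not-first
            ; first≢j = from-not-does (first ≟ᶠ j) (∧-conicalʳ (group s j) _ not-first)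
            ; last≢j = from-not-does (last ≟ᶠ j) (∧-conicalʳ (group s j ∧ not (does (first ≟ᶠ j))) _ int)
            }
            where
            not-first : (group s j ∧ not (does (first ≟ᶠ j))) ≡ true
            not-first = ∧-conicalˡ _ (not (does (last ≟ᶠ j))) int

          Spans : Fin n → Set
          Spans b = (lo b ≤ pos first × pos last ≤ hi b) ⊎
                    (adj G (rep f) b ≡ true × adj G (rep g) b ≡ true)

          spans⇒complete : ∀ {j b} → Interior j → b ∈ᵥ A → Spans b → ∀ {u} → u ∈ᵥ C j → adj G u b ≡ true
          spans⇒complete {j} I b∈A (inj₁ (lb≤first , last≤hb)) =
            spanning⇒complete (isComponent j) j-Clean first-free last-free (rep∈C j) first<j j<last
              b∈A lb≤first last≤hb
            where open Interior I
          spans⇒complete {j} I b∈A (inj₂ (fb , gb)) =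
            spanning⇒complete (isComponent j) j-Clean
              (rep-free j-Clean f≢j (covers-hi (rep f))) (rep-free j-Clean g≢j (covers-lo (rep g)))
              (rep∈C j) (ends-before j-Clean f≢j f<j) j<g
              b∈A (proj₂ (adj⇒overlap fb)) (proj₁ (adj⇒overlap gb))
            where open Interior I

          touches⇒spans : ∀ {j b u} → Interior j → b ∈ᵥ A → u ∈ᵥ C j → adj G u b ≡ true → Spans b
          touches⇒spans {j} {b} {u} I b∈A u∈C ub with Missed b in missed
          ... | false = inj₂ (adjacent-unless-Missed b∈A missed)
          ... | true = inj₁ (same-side⇒spans lb<last first<hb
                              (same-signature⇒same-side first≤last same-signature missed))
            where
            open Interior I
            u-inside : pos first < lo u × hi u < pos last
            u-inside = between-free (isComponent j) first-free last-free (rep∈C j) first<j j<last u∈C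
            lb<last : lo b < pos last
            lb<last = ≤-<-trans (proj₂ (adj⇒overlap ub)) (proj₂ u-inside)
            first<hb : pos first < hi b
            first<hb = <-≤-trans (proj₁ u-inside) (proj₁ (adj⇒overlap ub))
            first≤last : pos first ≤ pos last
            first≤last = last-max first first∈group
            same-signature : signature first ≡ signature last
            same-signature = trans (group⇒signature first∈group) (sym (group⇒signature last∈group))

          interior-isModule : ∀ {j} → Interior j → IsModule G (C j)
          interior-isModule {j} I w w∉C with A w in Aw | any? (λ u → (C j u ∧ adj G u w) ≟ᵇ true)
          ... | false | _ = inj₂ λ u u∈C → ¬-not λ wu →
            not-¬ (Component.closed (isComponent j) u∈C Aw (trans (adj-sym G u w) wu)) w∉C
          ... | true | yes (u₀ , hit) = inj₁ λ u u∈C → trans (adj-sym G w u) (spans⇒complete I Aw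
            (touches⇒spans I Aw (∧-conicalˡ (C j u₀) _ hit) (∧-conicalʳ (C j u₀) _ hit)) u∈C)
          ... | true | no miss = inj₂ λ u u∈C → ¬-not λ wu →
            miss (u , cong₂ _∧_ u∈C (trans (adj-sym G u w) wu))

          interior-neighbourhood : ∀ {j j′} → Interior j → Interior j′ →
            ∀ w → InNbhd G (C j) w → InNbhd G (C j′) w
          interior-neighbourhood {j} {j′} I I′ w (w∉C , u , u∈C , uw) with A w in Aw
          ... | false = ⊥-elim (not-¬ (Component.closed (isComponent j) u∈C Aw uw) w∉C)
          ... | true =
            w∉C′ , rep j′ , rep∈C j′ , spans⇒complete I′ Aw (touches⇒spans I Aw u∈C uw) (rep∈C j′)
            where
            w∉C′ : w ∉ᵥ C j′
            w∉C′ = ¬-not λ w∈C′ → not-¬ Aw (Component.avoids (isComponent j′) w∈C′)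

          rule : ModuleRuleApplicable G k
          rule = A , C ∘ e , isComponent ∘ e , (λ i i′ i≢i′ → disjoint (e i) (e i′) (i≢i′ ∘ e-injective)) ,
                 interior-isModule ∘ I ,
                 λ i w → mk⇔ (interior-neighbourhood (I i) (I F.zero) w) (interior-neighbourhood (I F.zero) (I i) w)
            where
            enumeration : Σ (Fin (3 + 2 * k) → Fin m) λ e →
              Injective _≡_ _≡_ e × (∀ i → interior (e i) ≡ true)
            enumeration = enumerate interior count-interior
            e : Fin (3 + 2 * k) → Fin m
            e = proj₁ enumeration
            e-injective : Injective _≡_ _≡_ e
            e-injective = proj₁ (proj₂ enumeration)
            I : ∀ i → Interior (e i)
            I i = interior⇒Interior (proj₂ (proj₂ enumeration) i)

      count-clean : ∀ k → ¬ ModuleRuleApplicable G k →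
        count clean ≤ suc ((r + r) + (r + r)) * (4 + 2 * k)
      count-clean k no-rule with any? (λ j → clean j ≟ᵇ true)
      ... | no none = ≤-trans (≤-reflexive (count-none λ j → ¬-not λ cj → none (j , cj))) z≤n
      ... | yes some = count-≤-fibres signature _ _ (λ j _ → signature-< j) group-small
        where
        open Signature (proj₁ (argmin clean pos some)) (proj₁ (argmax clean pos some))
                      (proj₂ (proj₂ (argmin clean pos some))) (proj₂ (proj₂ (argmax clean pos some)))
        group-small : ∀ s → count (group s) ≤ 4 + 2 * k
        group-small s with count (group s) ≤? 4 + 2 * k
        ... | yes small = small
        ... | no large = ⊥-elim (no-rule (LargeGroup.rule k s (≰⇒> large)))

bound-arithmetic : ∀ k r →
  2 * k + suc ((r + r) + (r + r)) * (4 + 2 * k) ≤ 12 * k * r + 4 * k + 18 * r + 4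
bound-arithmetic k r = ≤-trans (m≤m+n _ (4 * k * r + 2 * r)) (≤-reflexive (sym (slack k r)))
  where
  slack : ∀ k r → 12 * k * r + 4 * k + 18 * r + 4 ≡
                  (2 * k + suc ((r + r) + (r + r)) * (4 + 2 * k)) + (4 * k * r + 2 * r)
  slack = solve-∀

mainTheorem11 : ∀ {n} (G : Graph n) (k : ℕ) →
    IntervalCompletionYes G k →
    ¬ ModuleRuleApplicable G k →
    (r : ℕ) → 1 ≤ r → (A : VSet n) →
    -- any family of pairwise distinct components C of G ∖ A having a vertex
    -- v_C with |A ∖ N(v_C)| ≤ r has at most 12kr + 4k + 18r + 4 members
    (m : ℕ) (C : Fin m → VSet n) →
    (∀ i → IsComponentMinus G A (C i)) →
    (∀ i j → i ≢ j → Disjoint (C i) (C j)) →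
    (∀ i → ∃ λ v → v ∈ᵥ C i × nonNbrsIn G A v ≤ r) →
    m ≤ 12 * k * r + 4 * k + 18 * r + 4
-- The bound also holds for r = 0.
mainTheorem11 {n} G k (H , G⊆H , (lo , hi , lo≤hi , model) , few-added) no-rule r _ A m C
              isComponent disjoint reps =
  begin
    m                                             ≡⟨ sym (count-+-count-not dirty) ⟩
    count dirty + count (not ∘ dirty)             ≤⟨ +-mono-≤ (≤-trans count-dirty (*-monoʳ-≤ 2 few-added))
                                                              (count-clean k no-rule) ⟩
    2 * k + suc ((r + r) + (r + r)) * (4 + 2 * k) ≤⟨ bound-arithmetic k r ⟩
    12 * k * r + 4 * k + 18 * r + 4               ∎
  where
  open ≤-Reasoning
  open IntervalModel G H G⊆H lo hi lo≤hi model
  rep : Fin m → Fin n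
  rep i = proj₁ (reps i)
  open Family C isComponent disjoint rep (proj₁ ∘ proj₂ ∘ reps)
  open CleanComponents r (proj₂ ∘ proj₂ ∘ reps) (not ∘ dirty) not-dirty⇒Clean
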